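{- Let $w$ be a double occurrence word in ascending order of length $n$, $\nu\ge1$, and let $\mathcal I_1(\nu,k_1,\ell_1)$, $\mathcal I_2(\nu,k_2,\ell_2)$ be insertions into $w$ with $w\star\mathcal I_1(\nu,k_1,\ell_1)\sim w\star\mathcal I_2(\nu,k_2,\ell_2)$, $k_1=1$ and $\ell_2=n+1$. If $k_1=\ell_1<k_2\le\ell_2$, then $k_2=\ell_2$ and $k_2-\ell_1=2p\nu$ for some positive integer $p$. Moreover, if $\mathcal I_1,\mathcal I_2$ are both repeat insertions then $w\sim T_\rho(\nu,0,p)$, and if they are both return insertions then $w\sim T_\tau(\nu,0,p)$.
   Context: Alphabet $\Sigma=\mathbb{N}$; words are finite sequences over $\Sigma$, $|w|$ is length, $w^R$ the reverse. A double occurrence word (DOW) is a word in which every symbol occurs zero or exactly two times. An equivalence map is a morphism of $\Sigma^*$ induced by a bijection $\Sigma\to\Sigma$; $x\sim y$ means $f(x)=y$ for some equivalence map $f$. A word is in ascending order if it is empty or its first symbol is $1$ and the first occurrence of each symbol is one greater than the largest symbol preceding it. Insertions: for a DOW $w$ in ascending order with largest symbol $M$ ($M=0$ if $w$ is empty), $\nu\ge1$, $u=(M+1)\cdots(M+\nu)$ and $1\le k\le\ell\le|w|+1$, write $w=y_1y_2y_3$ with $|y_1|=k-1$, $|y_1y_2|=\ell-1$; the repeat insertion gives $w\star\rho(\nu,k,\ell)=y_1uy_2uy_3$ and the return insertion gives $w\star\tau(\nu,k,\ell)=y_1uy_2u^Ry_3$; $\mathcal I(\nu,k,\ell)$ denotes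 either. Tangled cords with $m=0$: for $\nu,j\ge1$, $s_0=\epsilon$ and $s_j=s_{j-1}\star\rho(\nu,|s_{j-1}|+1,|s_{j-1}|+1)$, $T_\rho(\nu,0,j)=s_j$; $t_0=\epsilon$ and $t_j=t_{j-1}\star\tau(\nu,|t_{j-1}|+1,|t_{j-1}|+1)$, $T_\tau(\nu,0,j)=t_j$. (Thus $T_\rho(\nu,0,j)\sim v_1v_1\cdots v_jv_j$ and $T_\tau(\nu,0,j)\sim v_1v_1^R\cdots v_jv_j^R$ for SOWs $v_i$ of length $\nu$ with disjoint symbol sets.) -}

module Defs where

open import Data.Nat using (ℕ; zero; suc; _+_; _∸_; _⊔_; _≟_)
open import Data.List using (List; []; _∷_; _++_; [_]; length; take; drop; map; foldr; reverse)
open import Data.List.Membership.Propositional using (_∉_)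
open import Data.Product using (Σ; _×_)
open import Data.Sum using (_⊎_)
open import Data.Unit using (⊤)
open import Relation.Nullary using (yes; no)
open import Relation.Binary.PropositionalEquality using (_≡_)
open import Function.Definitions using (Bijective)

Word : Set
Word = List ℕ

occ : ℕ → Word → ℕ
occ a [] = 0
occ a (b ∷ w) with a ≟ b
... | yes _ = suc (occ a w)
... | no _  = occ a w

DOW : Word → Set
DOW w = ∀ a → occ a w ≡ 0 ⊎ occ a w ≡ 2

maxSym : Word → ℕ
maxSym = foldr _⊔_ 0

-- ascending order: each first occurrence of a symbol equals one plus the
-- largest symbol preceding it (pre = the prefix read so far).
-- For the first letter the prefix is empty, so it must be 1.
AscFrom : Word → Word → Set
AscFrom pre [] = ⊤
AscFrom pre (a ∷ w) = (a ∉ pre → a ≡ suc (maxSym pre)) × AscFrom (pre ++ [ a ]) w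

Ascending : Word → Set
Ascending w = AscFrom [] w

_∼_ : Word → Word → Set
x ∼ y = Σ (ℕ → ℕ) (λ f → Bijective _≡_ _≡_ f × map f x ≡ y)

block : ℕ → ℕ → Word
block m zero = []
block m (suc ν) = block m ν ++ [ m + suc ν ]

-- kinds of insertion: repeat (ρ) or return (τ)
data Ins : Set where
  ρ τ : Ins

second : Ins → Word → Word
second ρ u = u
second τ u = reverse u

-- w ⋆ I(ν,k,ℓ) = y₁ u y₂ u' y₃ with |y₁| = k-1, |y₁y₂| = ℓ-1,
-- u = (M+1)…(M+ν), u' = u (repeat) or uᴿ (return)
insert : Ins → Word → ℕ → ℕ → ℕ → Word
insert I w ν k ℓ =
  take (k ∸ 1) w ++ u ++ drop (k ∸ 1) (take (ℓ ∸ 1) w) ++ second I u ++ drop (ℓ ∸ 1) w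
  where u = block (maxSym w) ν

-- tangled cords with m = 0: T_I(ν,0,j)
T : Ins → ℕ → ℕ → Word
T I ν zero = []
T I ν (suc j) = insert I (T I ν j) ν (suc (length (T I ν j))) (suc (length (T I ν j)))

-- With f the renaming, the left side is u I₁(u) w and the right side w₁ u w₂ I₂(u), where w = w₁ w₂
-- and u consists of fresh symbols. The image P = f(u) I₁(f(u)) of the leading cord shares no symbol
-- with f(w), so the copy of u on the right cannot start inside P: either I₂(u) would then lie inside
-- f(w), or f(w) inside I₂(u) while u lies inside P. So w₁, and with it w, begins with the
-- cord of f(u), whose symbols do not recur in the rest of the double occurrence word w, and the
-- argument repeats with f(u) in place of u. It can only stop when w₁ is used up, forcing w₂ to be
-- empty (k₂ = ℓ₂) and cutting w into p cords of length 2ν; ascending order then makes each cord the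
-- next block of fresh symbols, i.e. w = T_I(ν,0,p).

module Submission where

open import Defs
open import Data.Nat using (ℕ; zero; suc; _+_; _*_; _∸_; _≤_; _<_; _⊔_; z≤n; s≤s; s≤s⁻¹)
open import Data.Nat.Properties
open import Data.Nat.Induction using (<-wellFounded)
open import Data.Nat.Solver using (module +-*-Solver)
open import Induction.WellFounded using (Acc; acc)
open import Data.List using (List; []; _∷_; _++_; [_]; length; take; drop; map)
open import Data.List.Properties
  using (map-++; length-++; length-map; length-reverse; reverse-map; length-drop; ++-assoc; ++-identityʳ;
         ++-conicalˡ; ++-conicalʳ; ∷-injective; take-all; drop-all; take++drop≡id; map-id)
open import Data.List.Membership.Propositional using (_∈_)
open import Data.List.Membership.Propositional.Properties using (∈-map⁻; ∈-++⁻; ∈-++⁺ʳ)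
open import Data.List.Relation.Unary.Any using (here; there)
import Data.List.Relation.Unary.Any.Properties as Any
open import Data.List.Relation.Unary.All.Properties using (All¬⇒¬Any; ¬Any⇒All¬)
open import Data.List.Relation.Unary.AllPairs using ([]; _∷_)
open import Data.List.Relation.Unary.Unique.Propositional using (Unique)
import Data.List.Relation.Unary.Unique.Propositional.Properties as Unique
open import Data.List.Relation.Binary.Disjoint.Propositional using (Disjoint)
open import Data.List.Relation.Binary.Subset.Propositional using (_⊆_)
open import Data.List.Relation.Binary.Subset.Propositional.Properties using (xs⊆xs++ys; xs⊆ys++xs)
open import Data.Product using (Σ; ∃-syntax; _×_; _,_; proj₁; proj₂)
open import Data.Sum using (inj₁; inj₂)
open import Data.Empty using (⊥-elim)
open import Data.Unit using (tt)
open import Relation.Nullary using (Dec; yes; no; contradiction)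
open import Algebra.Properties.CommutativeSemigroup +-commutativeSemigroup using (x∙yz≈y∙xz)
open import Relation.Binary.PropositionalEquality hiding ([_])
open import Function using (_∘_)
open import Function.Definitions using (Injective)
import Function.Construct.Identity as Identity

private
  variable
    A : Set
    I : Ins
    a : ℕ
    xs ys : Word

occ-++ : ∀ a xs ys → occ a (xs ++ ys) ≡ occ a xs + occ a ys
occ-++ a []       ys = refl
occ-++ a (b ∷ xs) ys with a ≟ b
... | yes _ = cong suc (occ-++ a xs ys)
... | no  _ = occ-++ a xs ys

∈⇒1≤occ : ∀ xs → a ∈ xs → 1 ≤ occ a xs
∈⇒1≤occ {a} (b ∷ xs) a∈ with a ≟ b | a∈
... | yes _   | _          = s≤s z≤n
... | no  a≢b | here a≡b   = contradiction a≡b a≢b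
... | no  _   | there a∈xs = ∈⇒1≤occ xs a∈xs

AtMostTwice : Word → Set
AtMostTwice w = ∀ a → occ a w ≤ 2

DOW⇒AtMostTwice : ∀ {w} → DOW w → AtMostTwice w
DOW⇒AtMostTwice dow a with dow a
... | inj₁ occ≡0 = ≤-trans (≤-reflexive occ≡0) z≤n
... | inj₂ occ≡2 = ≤-reflexive occ≡2

AtMostTwice-++⁻ʳ : ∀ xs → AtMostTwice (xs ++ ys) → AtMostTwice ys
AtMostTwice-++⁻ʳ {ys} xs twice a =
  ≤-trans (m≤n+m (occ a ys) (occ a xs)) (≤-trans (≤-reflexive (sym (occ-++ a xs ys))) (twice a))

∈-second⁻ : ∀ I → a ∈ second I xs → a ∈ xs
∈-second⁻ ρ a∈ = a∈
∈-second⁻ τ a∈ = Any.reverse⁻ a∈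

∈-second⁺ : ∀ I → a ∈ xs → a ∈ second I xs
∈-second⁺ ρ a∈ = a∈
∈-second⁺ τ a∈ = Any.reverse⁺ a∈

map-second : ∀ I (f : ℕ → ℕ) xs → map f (second I xs) ≡ second I (map f xs)
map-second ρ f xs = refl
map-second τ f xs = reverse-map f xs

length-second : ∀ I (xs : Word) → length (second I xs) ≡ length xs
length-second ρ xs = refl
length-second τ xs = length-reverse xs

cord : Ins → Word → Word
cord I W = W ++ second I W

cord⊆ : ∀ I W → cord I W ⊆ W
cord⊆ I W a∈ with ∈-++⁻ W a∈
... | inj₁ a∈W  = a∈W
... | inj₂ a∈sW = ∈-second⁻ I a∈sW

length-cord : ∀ I W → length (cord I W) ≡ length W + length W
length-cord I W = trans (length-++ W) (cong (length W +_) (length-second I W))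

map-cord : ∀ I (f : ℕ → ℕ) W → map f (cord I W) ≡ cord I (map f W)
map-cord I f W = trans (map-++ f W (second I W)) (cong (map f W ++_) (map-second I f W))

AtMostTwice-cord⇒disjoint : ∀ I W rest → AtMostTwice (cord I W ++ rest) → Disjoint W rest
AtMostTwice-cord⇒disjoint I W rest twice {a} (a∈W , a∈rest) = ≤⇒≯ (twice a) (begin-strict
  2                                            <⟨ +-mono-≤ (+-mono-≤ (∈⇒1≤occ W a∈W)
                                                    (∈⇒1≤occ (second I W) (∈-second⁺ I a∈W)))
                                                    (∈⇒1≤occ rest a∈rest) ⟩
  occ a W + occ a (second I W) + occ a rest    ≡⟨ cong (_+ occ a rest) (occ-++ a W (second I W)) ⟨
  occ a (cord I W) + occ a rest                ≡⟨ occ-++ a (cord I W) rest ⟨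
  occ a (cord I W ++ rest)                     ∎)
  where open ≤-Reasoning

map-disjoint : ∀ {f : ℕ → ℕ} → Injective _≡_ _≡_ f → Disjoint xs ys → Disjoint (map f xs) (map f ys)
map-disjoint {ys = ys} {f} f-inj xs#ys (fx∈ , fy∈) with ∈-map⁻ f fx∈ | ∈-map⁻ f fy∈
... | x , x∈xs , refl | y , y∈ys , fx≡fy = xs#ys (x∈xs , subst (_∈ ys) (sym (f-inj fx≡fy)) y∈ys)

++-split : ∀ (xs ys zs ts : List A) → xs ++ ys ≡ zs ++ ts → length xs ≤ length zs →
           ∃[ mid ] zs ≡ xs ++ mid × ys ≡ mid ++ ts
++-split []       ys zs       ts eq _         = zs , refl , eq
++-split (x ∷ xs) ys (z ∷ zs) ts eq (s≤s len) with ∷-injective eq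
... | refl , eq′ with ++-split xs ys zs ts eq′ len
...   | mid , zs≡ , ys≡ = mid , cong (x ∷_) zs≡ , ys≡

++-split-⊆ : ∀ (xs ys zs ts : List A) → xs ++ ys ≡ zs ++ ts → length xs ≤ length zs →
             xs ⊆ zs × ts ⊆ ys
++-split-⊆ xs ys zs ts eq len with ++-split xs ys zs ts eq len
... | mid , refl , refl = xs⊆xs++ys xs mid , xs⊆ys++xs ts mid

⊆-disjoint⇒[] : ys ⊆ xs → Disjoint xs ys → ys ≡ []
⊆-disjoint⇒[] {[]}    _     _     = refl
⊆-disjoint⇒[] {y ∷ _} ys⊆xs xs#ys = ⊥-elim (xs#ys (ys⊆xs (here refl) , here refl))

-- Either R is long enough to contain second I Q, and then the first symbol of Q lies in P and in R,
-- or R is so short that R ⊆ second I Q while Q ⊆ P.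
block-in-cord⇒rest≡[] : ∀ I {ν} (P R w₁ w₂ Q : Word) → 1 ≤ ν → length Q ≡ ν → length P ≡ ν + ν →
  length R ≡ length w₁ + length w₂ → Disjoint P R →
  P ++ R ≡ w₁ ++ Q ++ w₂ ++ second I Q → length w₁ < ν + ν → R ≡ []
block-in-cord⇒rest≡[] I P R w₁ w₂ [] ν≥1 lQ _ _ _ _ _ = contradiction lQ (<⇒≢ ν≥1)
block-in-cord⇒rest≡[] I {ν} P R w₁ w₂ Q@(q ∷ _) _ lQ lP lR P#R eq w₁<ν+ν = by-length-of-R (ν ≤? length R)
  where
  open ≤-Reasoning

  Q′ : Word
  Q′ = second I Q

  length-w₁Qw₂ : length (w₁ ++ Q ++ w₂) ≡ ν + length R
  length-w₁Qw₂ = begin-equality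
    length (w₁ ++ Q ++ w₂)             ≡⟨ trans (length-++ w₁) (cong (length w₁ +_) (length-++ Q)) ⟩
    length w₁ + (length Q + length w₂) ≡⟨ cong (λ l → length w₁ + (l + length w₂)) lQ ⟩
    length w₁ + (ν + length w₂)        ≡⟨ x∙yz≈y∙xz (length w₁) ν (length w₂) ⟩
    ν + (length w₁ + length w₂)        ≡⟨ cong (ν +_) lR ⟨
    ν + length R                       ∎

  eq′ : P ++ R ≡ (w₁ ++ Q ++ w₂) ++ Q′
  eq′ = trans eq (sym (trans (++-assoc w₁ (Q ++ w₂) Q′) (cong (w₁ ++_) (++-assoc Q w₂ Q′))))

  by-length-of-R : Dec (ν ≤ length R) → R ≡ []
  by-length-of-R (yes ν≤R) = ⊥-elim (P#R (q∈P , Q′⊆R (∈-second⁺ I (here refl))))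
    where
    q∈P : q ∈ P
    q∈P = proj₁ (++-split-⊆ (w₁ ++ [ q ]) _ P R (trans (++-assoc w₁ [ q ] _) (sym eq)) (begin
        length (w₁ ++ [ q ]) ≡⟨ length-++ w₁ ⟩
        length w₁ + 1        ≡⟨ +-comm (length w₁) 1 ⟩
        suc (length w₁)      ≤⟨ w₁<ν+ν ⟩
        ν + ν                ≡⟨ lP ⟨
        length P             ∎))
      (∈-++⁺ʳ w₁ (here refl))
    Q′⊆R : Q′ ⊆ R
    Q′⊆R = proj₂ (++-split-⊆ P R (w₁ ++ Q ++ w₂) Q′ eq′ (begin
      length P             ≡⟨ lP ⟩
      ν + ν                ≤⟨ +-monoʳ-≤ ν ν≤R ⟩
      ν + length R         ≡⟨ length-w₁Qw₂ ⟨
      length (w₁ ++ Q ++ w₂) ∎))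
  by-length-of-R (no ν≰R) = ⊆-disjoint⇒[] (Q⊆P ∘ ∈-second⁻ I ∘ R⊆Q′) P#R
    where
    R≤ν : length R ≤ ν
    R≤ν = <⇒≤ (≰⇒> ν≰R)
    w₁≤R : length w₁ ≤ length R
    w₁≤R = ≤-trans (m≤m+n (length w₁) (length w₂)) (≤-reflexive (sym lR))
    Q⊆P : Q ⊆ P
    Q⊆P = proj₁ (++-split-⊆ (w₁ ++ Q) _ P R (trans (++-assoc w₁ Q _) (sym eq)) (begin
        length (w₁ ++ Q) ≡⟨ trans (length-++ w₁) (cong (length w₁ +_) lQ) ⟩
        length w₁ + ν    ≤⟨ +-monoˡ-≤ ν (≤-trans w₁≤R R≤ν) ⟩
        ν + ν            ≡⟨ lP ⟨
        length P         ∎)) ∘ xs⊆ys++xs Q w₁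
    R⊆Q′ : R ⊆ Q′
    R⊆Q′ = proj₂ (++-split-⊆ (w₁ ++ Q ++ w₂) Q′ P R (sym eq′) (begin
      length (w₁ ++ Q ++ w₂) ≡⟨ length-w₁Qw₂ ⟩
      ν + length R           ≤⟨ +-monoʳ-≤ ν R≤ν ⟩
      ν + ν                  ≡⟨ lP ⟨
      length P               ∎))

∈⇒≤maxSym : ∀ w → a ∈ w → a ≤ maxSym w
∈⇒≤maxSym (b ∷ w) (here refl)  = m≤m⊔n b (maxSym w)
∈⇒≤maxSym (b ∷ w) (there a∈w) = ≤-trans (∈⇒≤maxSym w a∈w) (m≤n⊔m b (maxSym w))

maxSym-++ : ∀ xs ys → maxSym (xs ++ ys) ≡ maxSym xs ⊔ maxSym ys
maxSym-++ []       ys = refl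
maxSym-++ (x ∷ xs) ys = trans (cong (x ⊔_) (maxSym-++ xs ys)) (sym (⊔-assoc x (maxSym xs) (maxSym ys)))

maxSym-∷ʳ-suc : ∀ pre → maxSym (pre ++ [ suc (maxSym pre) ]) ≡ suc (maxSym pre)
maxSym-∷ʳ-suc pre = begin
  maxSym (pre ++ [ suc (maxSym pre) ])     ≡⟨ maxSym-++ pre [ suc (maxSym pre) ] ⟩
  maxSym pre ⊔ (suc (maxSym pre) ⊔ 0)      ≡⟨ cong (maxSym pre ⊔_) (⊔-identityʳ (suc (maxSym pre))) ⟩
  maxSym pre ⊔ suc (maxSym pre)            ≡⟨ m≤n⇒m⊔n≡n (n≤1+n (maxSym pre)) ⟩
  suc (maxSym pre)                         ∎
  where open ≡-Reasoning

block-suc : ∀ m k → block m (suc k) ≡ suc m ∷ block (suc m) k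
block-suc m zero    = cong [_] (+-comm m 1)
block-suc m (suc k) = cong₂ _++_ (block-suc m k) (cong [_] (+-suc m (suc k)))

length-block : ∀ m k → length (block m k) ≡ k
length-block m zero    = refl
length-block m (suc k) = trans (cong length (block-suc m k)) (cong suc (length-block (suc m) k))

∈-block⇒> : ∀ m k → a ∈ block m k → m < a
∈-block⇒> m (suc k) a∈ with subst (_ ∈_) (block-suc m k) a∈
... | here refl   = ≤-refl
... | there a∈bs = <-trans (n<1+n m) (∈-block⇒> (suc m) k a∈bs)

block-unique : ∀ m k → Unique (block m k)
block-unique m zero    = []
block-unique m (suc k) = subst Unique (sym (block-suc m k))
  (¬Any⇒All¬ _ (<-irrefl refl ∘ ∈-block⇒> (suc m) k) ∷ block-unique (suc m) k)

block-maxSym-disjoint : ∀ w k → Disjoint (block (maxSym w) k) w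
block-maxSym-disjoint w k (a∈block , a∈w) = <⇒≱ (∈-block⇒> (maxSym w) k a∈block) (∈⇒≤maxSym w a∈w)

AscFrom-++⁻ˡ : ∀ pre xs {ys} → AscFrom pre (xs ++ ys) → AscFrom pre xs
AscFrom-++⁻ˡ pre []       _                 = tt
AscFrom-++⁻ˡ pre (x ∷ xs) (x-fresh , asc) = x-fresh , AscFrom-++⁻ˡ (pre ++ [ x ]) xs asc

AscFrom-++⁻ʳ : ∀ pre xs {ys} → AscFrom pre (xs ++ ys) → AscFrom (pre ++ xs) ys
AscFrom-++⁻ʳ pre []       {ys} asc       = subst (λ p → AscFrom p ys) (sym (++-identityʳ pre)) asc
AscFrom-++⁻ʳ pre (x ∷ xs) {ys} (_ , asc) = subst (λ p → AscFrom p ys) (++-assoc pre [ x ] xs)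
  (AscFrom-++⁻ʳ (pre ++ [ x ]) xs asc)

AscFrom-fresh⇒block : ∀ pre W → Unique W → Disjoint pre W → AscFrom pre W →
                      W ≡ block (maxSym pre) (length W)
AscFrom-fresh⇒block pre []      _                  _      _                 = refl
AscFrom-fresh⇒block pre (a ∷ W) (a∉W ∷ W-unique) pre#aW (a-fresh , asc) = begin
  a ∷ W                                                 ≡⟨ cong (a ∷_) W≡block ⟩
  a ∷ block (maxSym (pre ++ [ a ])) (length W)          ≡⟨ cong (λ b → b ∷ block (maxSym (pre ++ [ b ])) (length W)) a≡ ⟩
  suc M ∷ block (maxSym (pre ++ [ suc M ])) (length W) ≡⟨ cong (λ m → suc M ∷ block m (length W)) (maxSym-∷ʳ-suc pre) ⟩
  suc M ∷ block (suc M) (length W)                      ≡⟨ block-suc M (length W) ⟨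
  block M (suc (length W))                              ∎
  where
  open ≡-Reasoning

  M : ℕ
  M = maxSym pre

  a≡ : a ≡ suc M
  a≡ = a-fresh (λ a∈pre → pre#aW (a∈pre , here refl))

  pre+a#W : Disjoint (pre ++ [ a ]) W
  pre+a#W (b∈ , b∈W) with ∈-++⁻ pre b∈
  ... | inj₁ b∈pre       = pre#aW (b∈pre , there b∈W)
  ... | inj₂ (here refl) = All¬⇒¬Any a∉W b∈W

  W≡block : W ≡ block (maxSym (pre ++ [ a ])) (length W)
  W≡block = AscFrom-fresh⇒block (pre ++ [ a ]) W W-unique pre+a#W asc

data Cords (I : Ins) (ν : ℕ) : Word → ℕ → Set where
  []   : Cords I ν [] 0
  cons : ∀ {W rest p} → length W ≡ ν → Unique W → Disjoint W rest →
         Cords I ν rest p → Cords I ν (cord I W ++ rest) (suc p)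

length-cords : ∀ {ν w p} → Cords I ν w p → length w ≡ 2 * p * ν
length-cords []                                       = refl
length-cords {I} {ν} (cons {W} {rest} {p} lW _ _ cs) = begin
  length (cord I W ++ rest)        ≡⟨ length-++ (cord I W) ⟩
  length (cord I W) + length rest  ≡⟨ cong₂ _+_ (trans (length-cord I W) (cong₂ _+_ lW lW)) (length-cords cs) ⟩
  (ν + ν) + 2 * p * ν              ≡⟨ solve 2 (λ p ν → (ν :+ ν) :+ con 2 :* p :* ν := con 2 :* (con 1 :+ p) :* ν)
                                             refl p ν ⟩
  2 * suc p * ν                    ∎
  where
  open ≡-Reasoning
  open +-*-Solver

nonempty-cords⇒1≤p : ∀ {ν w p} → Cords I ν w p → 1 ≤ length w → 1 ≤ p
nonempty-cords⇒1≤p []             ()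
nonempty-cords⇒1≤p (cons _ _ _ _) _ = s≤s z≤n

insert-at-end : ∀ I w ν k → insert I w ν k (suc (length w)) ≡
  take (k ∸ 1) w ++ block (maxSym w) ν ++ drop (k ∸ 1) w ++ second I (block (maxSym w) ν)
insert-at-end I w ν k
  rewrite take-all (length w) w ≤-refl | drop-all (length w) w ≤-refl
        | ++-identityʳ (second I (block (maxSym w) ν)) = refl

T-suc : ∀ I ν j → T I ν (suc j) ≡ T I ν j ++ cord I (block (maxSym (T I ν j)) ν)
T-suc I ν j = trans (insert-at-end I t ν (suc (length t)))
  (cong₂ (λ t′ d → t′ ++ u ++ d ++ second I u)
         (take-all (length t) t ≤-refl) (drop-all (length t) t ≤-refl))
  where
  t : Word
  t = T I ν j

  u : Word
  u = block (maxSym t) ν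

T-++-cords : ∀ {ν w p} j → Cords I ν w p → Disjoint (T I ν j) w → AscFrom (T I ν j) w →
  T I ν j ++ w ≡ T I ν (j + p)
T-++-cords {I} {ν} j [] _ _ = trans (++-identityʳ (T I ν j)) (cong (T I ν) (sym (+-identityʳ j)))
T-++-cords {I} {ν} j (cons {W} {rest} {p} lW W-unique W#rest cs) t#w asc = begin
  t ++ cord I W ++ rest    ≡⟨ ++-assoc t (cord I W) rest ⟨
  (t ++ cord I W) ++ rest  ≡⟨ cong (_++ rest) t-cord ⟩
  T I ν (suc j) ++ rest    ≡⟨ T-++-cords (suc j) cs t′#rest asc′ ⟩
  T I ν (suc j + p)        ≡⟨ cong (T I ν) (+-suc j p) ⟨
  T I ν (j + suc p)        ∎
  where
  open ≡-Reasoning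

  t : Word
  t = T I ν j

  W≡block : W ≡ block (maxSym t) ν
  W≡block = trans
    (AscFrom-fresh⇒block t W W-unique t#W (AscFrom-++⁻ˡ t W (AscFrom-++⁻ˡ t (cord I W) asc)))
    (cong (block (maxSym t)) lW)
    where
    t#W : Disjoint t W
    t#W (a∈t , a∈W) = t#w (a∈t , xs⊆xs++ys (cord I W) rest (xs⊆xs++ys W _ a∈W))

  t-cord : t ++ cord I W ≡ T I ν (suc j)
  t-cord = trans (cong (λ V → t ++ cord I V) W≡block) (sym (T-suc I ν j))

  asc′ : AscFrom (T I ν (suc j)) rest
  asc′ = subst (λ p → AscFrom p rest) t-cord (AscFrom-++⁻ʳ t (cord I W) asc)

  t-cord#rest : Disjoint (t ++ cord I W) rest
  t-cord#rest (a∈ , a∈rest) with ∈-++⁻ t a∈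
  ... | inj₁ a∈t    = t#w (a∈t , xs⊆ys++xs rest (cord I W) a∈rest)
  ... | inj₂ a∈cord = W#rest (cord⊆ I W a∈cord , a∈rest)

  t′#rest : Disjoint (T I ν (suc j)) rest
  t′#rest = subst (λ p → Disjoint p rest) t-cord t-cord#rest

ascending-cords⇒T : ∀ {ν w p} → Cords I ν w p → Ascending w → w ≡ T I ν p
ascending-cords⇒T cs asc = T-++-cords 0 cs (λ { (() , _) }) asc

map≡[]⇒≡[] : ∀ {f : ℕ → ℕ} xs → map f xs ≡ [] → xs ≡ []
map≡[]⇒≡[] []      _  = refl
map≡[]⇒≡[] (_ ∷ _) ()

module _ {f : ℕ → ℕ} (f-inj : Injective _≡_ _≡_ f) (I₁ I₂ : Ins) {ν : ℕ} (ν≥1 : 1 ≤ ν)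
         {Q : Word} (lQ : length Q ≡ ν) where

  -- w₁ must begin with the cord of map f V, so w does too, and map f V takes over the role of V.
  matching⇒cords : ∀ V w₁ w₂ → Acc _<_ (length w₁) →
    length V ≡ ν → Unique V → Disjoint V (w₁ ++ w₂) → AtMostTwice (w₁ ++ w₂) →
    map f (cord I₁ V ++ w₁ ++ w₂) ≡ w₁ ++ Q ++ w₂ ++ second I₂ Q →
    w₂ ≡ [] × ∃[ p ] Cords I₁ ν w₁ p
  matching⇒cords V w₁ w₂ (acc smaller) lV V-unique V#w twice eq = by-length-of-w₁ (ν + ν ≤? length w₁)
    where
    W : Word
    W = map f V

    P : Word
    P = cord I₁ W

    R : Word
    R = map f (w₁ ++ w₂)

    lW : length W ≡ ν
    lW = trans (length-map f V) lV

    lP : length P ≡ ν + ν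
    lP = trans (length-cord I₁ W) (cong₂ _+_ lW lW)

    P++R : P ++ R ≡ w₁ ++ Q ++ w₂ ++ second I₂ Q
    P++R = trans (sym (trans (map-++ f (cord I₁ V) (w₁ ++ w₂)) (cong (_++ R) (map-cord I₁ f V)))) eq

    P#R : Disjoint P R
    P#R (a∈P , a∈R) = map-disjoint f-inj V#w (cord⊆ I₁ W a∈P , a∈R)

    peel : ∃[ mid ] w₁ ≡ P ++ mid × R ≡ mid ++ Q ++ w₂ ++ second I₂ Q → w₂ ≡ [] × ∃[ p ] Cords I₁ ν w₁ p
    peel (mid , w₁≡ , R≡) = extend (matching⇒cords W mid w₂ (smaller mid<w₁) lW W-unique
                                      W#mid++w₂ (AtMostTwice-++⁻ʳ P twice′) eq′)
      where
      W-unique : Unique W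
      W-unique = Unique.map⁺ f-inj V-unique

      w≡ : w₁ ++ w₂ ≡ P ++ mid ++ w₂
      w≡ = trans (cong (_++ w₂) w₁≡) (++-assoc P mid w₂)

      twice′ : AtMostTwice (P ++ mid ++ w₂)
      twice′ = subst AtMostTwice w≡ twice

      W#mid++w₂ : Disjoint W (mid ++ w₂)
      W#mid++w₂ = AtMostTwice-cord⇒disjoint I₁ W (mid ++ w₂) twice′

      eq′ : map f (P ++ mid ++ w₂) ≡ mid ++ Q ++ w₂ ++ second I₂ Q
      eq′ = trans (cong (map f) (sym w≡)) R≡

      mid<w₁ : length mid < length w₁
      mid<w₁ = begin-strict
        length mid            <⟨ m<n+m (length mid) (≤-trans ν≥1 (m≤m+n ν ν)) ⟩
        ν + ν + length mid    ≡⟨ cong (_+ length mid) lP ⟨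
        length P + length mid ≡⟨ length-++ P ⟨
        length (P ++ mid)     ≡⟨ cong length w₁≡ ⟨
        length w₁             ∎
        where open ≤-Reasoning

      extend : w₂ ≡ [] × ∃[ p ] Cords I₁ ν mid p → w₂ ≡ [] × ∃[ p ] Cords I₁ ν w₁ p
      extend (w₂≡[] , p , cs) = w₂≡[] , suc p , subst (λ x → Cords I₁ ν x (suc p)) (sym w₁≡)
        (cons lW W-unique (λ (a∈W , a∈mid) → W#mid++w₂ (a∈W , xs⊆xs++ys mid w₂ a∈mid)) cs)

    by-length-of-w₁ : Dec (ν + ν ≤ length w₁) → w₂ ≡ [] × ∃[ p ] Cords I₁ ν w₁ p
    by-length-of-w₁ (yes ν+ν≤w₁) = peel (++-split P R w₁ _ P++R (≤-trans (≤-reflexive lP) ν+ν≤w₁))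
    by-length-of-w₁ (no ν+ν≰w₁) =
      ++-conicalʳ w₁ w₂ w≡[] , 0 , subst (λ x → Cords I₁ ν x 0) (sym (++-conicalˡ w₁ w₂ w≡[])) []
      where
      lR : length R ≡ length w₁ + length w₂
      lR = trans (length-map f (w₁ ++ w₂)) (length-++ w₁)
      w≡[] : w₁ ++ w₂ ≡ []
      w≡[] = map≡[]⇒≡[] (w₁ ++ w₂) (block-in-cord⇒rest≡[] I₂ P R w₁ w₂ Q ν≥1 lQ lP lR P#R P++R (≰⇒> ν+ν≰w₁))

drop≡[]⇒take≡ : ∀ k (xs : List A) → drop k xs ≡ [] → take k xs ≡ xs
drop≡[]⇒take≡ k xs drop≡[] = begin
  take k xs               ≡⟨ ++-identityʳ (take k xs) ⟨
  take k xs ++ []         ≡⟨ cong (take k xs ++_) drop≡[] ⟨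
  take k xs ++ drop k xs  ≡⟨ take++drop≡id k xs ⟩
  xs                      ∎
  where open ≡-Reasoning

front-and-end-insertions⇒cords : ∀ {f : ℕ → ℕ} → Injective _≡_ _≡_ f → ∀ I₁ I₂ {ν} → 1 ≤ ν → ∀ w k → DOW w →
  map f (insert I₁ w ν 1 1) ≡ insert I₂ w ν (suc k) (suc (length w)) →
  length w ≤ k × ∃[ p ] Cords I₁ ν w p
front-and-end-insertions⇒cords {f} f-inj I₁ I₂ {ν} ν≥1 w k dow eq =
  m∸n≡0⇒m≤n (trans (sym (length-drop k w)) (cong length drop≡[])) ,
  p , subst (λ x → Cords I₁ ν x p) (drop≡[]⇒take≡ k w drop≡[]) cs
  where
  u : Word
  u = block (maxSym w) ν

  lu : length u ≡ ν
  lu = length-block (maxSym w) ν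

  w≡ : take k w ++ drop k w ≡ w
  w≡ = take++drop≡id k w

  matching : map f (cord I₁ u ++ take k w ++ drop k w) ≡ take k w ++ u ++ drop k w ++ second I₂ u
  matching = begin
    map f (cord I₁ u ++ take k w ++ drop k w)  ≡⟨ cong (λ x → map f (cord I₁ u ++ x)) w≡ ⟩
    map f (cord I₁ u ++ w)                     ≡⟨ cong (map f) (++-assoc u (second I₁ u) w) ⟩
    map f (insert I₁ w ν 1 1)                  ≡⟨ eq ⟩
    insert I₂ w ν (suc k) (suc (length w))     ≡⟨ insert-at-end I₂ w ν (suc k) ⟩
    take k w ++ u ++ drop k w ++ second I₂ u   ∎
    where open ≡-Reasoning

  cords-of-take : drop k w ≡ [] × ∃[ p ] Cords I₁ ν (take k w) p
  cords-of-take = matching⇒cords f-inj I₁ I₂ ν≥1 {u} lu u (take k w) (drop k w) (<-wellFounded _) lu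
    (block-unique (maxSym w) ν) (subst (Disjoint u) (sym w≡) (block-maxSym-disjoint w ν))
    (subst AtMostTwice (sym w≡) (DOW⇒AtMostTwice {w} dow)) matching

  drop≡[] : drop k w ≡ []
  drop≡[] = proj₁ cords-of-take

  p : ℕ
  p = proj₁ (proj₂ cords-of-take)

  cs : Cords I₁ ν (take k w) p
  cs = proj₂ (proj₂ cords-of-take)

≡⇒∼ : ∀ {x y} → x ≡ y → x ∼ y
≡⇒∼ {x} refl = (λ a → a) , Identity.bijective _≡_ , map-id x

lemma3p9 : (w : Word) (n ν : ℕ) (I₁ I₂ : Ins) (k₁ ℓ₁ k₂ ℓ₂ : ℕ) →
    DOW w → Ascending w → length w ≡ n → 1 ≤ ν →
    1 ≤ k₁ → k₁ ≤ ℓ₁ → ℓ₁ ≤ suc n →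
    1 ≤ k₂ → k₂ ≤ ℓ₂ → ℓ₂ ≤ suc n →
    insert I₁ w ν k₁ ℓ₁ ∼ insert I₂ w ν k₂ ℓ₂ →
    k₁ ≡ 1 → ℓ₂ ≡ suc n →
    k₁ ≡ ℓ₁ → ℓ₁ < k₂ →
    Σ ℕ (λ p → 1 ≤ p × k₂ ≡ ℓ₂ × k₂ ∸ ℓ₁ ≡ 2 * p * ν
      × (I₁ ≡ ρ → I₂ ≡ ρ → w ∼ T ρ ν p)
      × (I₁ ≡ τ → I₂ ≡ τ → w ∼ T τ ν p))
lemma3p9 w .(length w) ν I₁ I₂ .1 .1 .(suc k) .(suc (length w)) dow asc refl ν≥1 _ _ _ _ k₂≤ℓ₂ _
  (f , (f-inj , _) , eq) refl refl refl (s≤s {n = k} 1≤k) =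
  p , nonempty-cords⇒1≤p cs (subst (1 ≤_) k≡n 1≤k) , cong suc k≡n , trans k≡n (length-cords cs) ,
  (λ { refl _ → w∼T }) , (λ { refl _ → w∼T })
  where
  cords-of-w : length w ≤ k × ∃[ p ] Cords I₁ ν w p
  cords-of-w = front-and-end-insertions⇒cords f-inj I₁ I₂ ν≥1 w k dow eq

  k≡n : k ≡ length w
  k≡n = ≤-antisym (s≤s⁻¹ k₂≤ℓ₂) (proj₁ cords-of-w)

  p : ℕ
  p = proj₁ (proj₂ cords-of-w)

  cs : Cords I₁ ν w p
  cs = proj₂ (proj₂ cords-of-w)

  w∼T : w ∼ T I₁ ν p
  w∼T = ≡⇒∼ (ascending-cords⇒T cs asc)
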